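{- Let $C$ be a 3-SAT instance and let $\mathrm{red}_{\rm EPS}(C)$ be the tuple of periods constructed in the context. If $C$ is satisfiable, then $\mathrm{red}_{\rm EPS}(C)$ has an EPS schedule.
   Context: A 3-SAT instance $C=\bigwedge_{j=1}^m C_j$ over variables $x_1,\ldots,x_n$ has clauses $C_j=c_{j1}\vee c_{j2}\vee c_{j3}$ of three distinct literals, and no clause contains both a variable and its negation. Construction $\mathrm{red}_{\rm EPS}(C)$: let $p_1<\cdots<p_{2n}$ be the first $2n$ primes greater than $\max(m,n)$; set $\mathrm{rep}_1(x_i)=p_{2i-1}$, $\mathrm{rep}_1(\bar x_i)=p_{2i}$. The output list consists of: for each of the $2n$ literals $y$, exactly $\mathrm{rep}_1(y)^2-\mathrm{rep}_1(y)$ copies of the period $2n\,\mathrm{rep}_1(y)^2$; for each $i\in[n]$ one period $f_i=2n\,\mathrm{rep}_1(x_i)\,\mathrm{rep}_1(\bar x_i)$; for each clause $C_j$ one period $2n\,(\mathrm{rep}_1(c_{j1})\mathrm{rep}_1(c_{j2})\mathrm{rep}_1(c_{j3}))^2$. An EPS schedule for a tuple $(a_1,\ldots,a_k)$ is a map $\sigma:\mathbb{Z}\to\{1,\ldots,k\}\cup\{\bot\}$ such that for each task $i$, $\sigma^{ -1}(\{i\})$ is nonempty and consecutive occurrences of task $i$ are exactly $a_i$ apart. -}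

module Defs where

open import Data.Nat using (ℕ; zero; suc; _+_; _*_; _∸_; _^_; _<_; _⊔_)
open import Data.Nat.Primality using (Prime)
open import Data.Fin using (Fin; toℕ)
open import Data.Bool using (Bool; true; false)
open import Data.Product using (_×_; _,_; proj₁; Σ; ∃; ∃-syntax)
open import Data.Maybe using (Maybe; just)
open import Data.List using (List; _∷_; []; length; lookup; replicate; _++_; concatMap; map)
open import Data.List.Relation.Unary.All using (All)
open import Data.Integer as ℤ using (ℤ; +_)
open import Relation.Binary.PropositionalEquality using (_≡_; _≢_)
open import Data.Fin using () renaming (_≟_ to _≟F_)

-- A literal over variables x_0..x_{n-1}: (i , true) is x_i, (i , false) is ¬x_i.
Literal : ℕ → Set
Literal n = Fin n × Bool

var : ∀ {n} → Literal n → Fin n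
var = proj₁

complement : ∀ {n} → Literal n → Literal n
complement (i , true)  = (i , false)
complement (i , false) = (i , true)

Clause : ℕ → Set
Clause n = Fin 3 → Literal n

WFClause : ∀ {n} → Clause n → Set
WFClause c = (∀ a b → a ≢ b → c a ≢ c b) × (∀ a b → c a ≢ complement (c b))

record Instance : Set where
  field
    n       : ℕ
    m       : ℕ
    clause  : Fin m → Clause n
    wf      : ∀ j → WFClause (clause j)
open Instance public

Assignment : ℕ → Set
Assignment n = Fin n → Bool

litTrue : ∀ {n} → Assignment n → Literal n → Set
litTrue α (i , b) = α i ≡ b

Satisfiable : Instance → Set
Satisfiable C = ∃[ α ] (∀ j → ∃[ k ] litTrue α (clause C j k))

-- The first K primes greater than B, listed as p 0 < p 1 < ... < p (K-1).
-- (The specification determines p 0 .. p (K-1) uniquely.)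

FirstPrimesAbove : ℕ → ℕ → (ℕ → ℕ) → Set
FirstPrimesAbove B K p =
  (∀ k → k < K → Prime (p k) × B < p k)
  × (∀ k → suc k < K → p k < p (suc k))
  × (∀ k q → k < K → Prime q → B < q → q < p k → ∃[ j ] (j < k × q ≡ p j))

-- The reduction red_EPS.  Given p with p 0 = p_1, ..., p (2n-1) = p_{2n}:
-- rep1(x_i) = p_{2i-1}, rep1(¬x_i) = p_{2i}   (0-based: p (2i), p (2i+1)).

rep1 : ∀ {n} → (ℕ → ℕ) → Literal n → ℕ
rep1 p (i , true)  = p (2 * toℕ i)
rep1 p (i , false) = p (2 * toℕ i + 1)

allFinL : (n : ℕ) → List (Fin n)
allFinL n = Data.List.tabulate {n = n} (λ i → i)

redEPS : Instance → (ℕ → ℕ) → List ℕ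
redEPS C p =
  concatMap (λ y → replicate (r y ^ 2 ∸ r y) (2 * N * r y ^ 2)) literals
  ++ map (λ i → 2 * N * r (i , true) * r (i , false)) (allFinL N)
  ++ map (λ j → 2 * N * (r (clause C j 0F) * r (clause C j 1F) * r (clause C j 2F)) ^ 2)
         (allFinL (m C))
  where
  N = n C
  r : Literal N → ℕ
  r = rep1 p
  open import Data.Fin using (#_)
  0F 1F 2F : Fin 3
  0F = # 0
  1F = # 1
  2F = # 2
  literals : List (Literal N)
  literals = concatMap (λ i → (i , true) ∷ (i , false) ∷ []) (allFinL N)

-- Exact periodic schedules (EPS).
-- σ : ℤ → Maybe (Fin k), nothing = ⊥ (idle).  Task i occurs, and from every
-- occurrence t the previous and next occurrences are exactly a_i away.

HasEPSSchedule : List ℕ → Set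
HasEPSSchedule a =
  Σ (ℤ → Maybe (Fin (length a))) λ σ → ((i : Fin (length a)) →
     let ai = + lookup a i in
       (∃[ t ] σ t ≡ just i)
     × (∀ t → σ t ≡ just i →
          σ (t ℤ.+ ai) ≡ just i
        × σ (t ℤ.- ai) ≡ just i
        × (∀ d → + 0 ℤ.< d → d ℤ.< ai → σ (t ℤ.+ d) ≢ just i)))

-- Every task τ with period 2n · Q τ gets a literal lit τ and an integer residue τ, and runs
-- exactly at the times t ≡ code (lit τ) + 2n · residue τ (mod 2n · Q τ), where code is an
-- injective map from the literals to [0, 2n).  Two such classes meet only if the tasks have
-- the same literal and their residues agree modulo every common divisor of their Q's.  The
-- r² − r copies of period 2n · r(y)² take the residues modulo r(y)² that r(y) does not divide;
-- the task f_i takes the literal of x_i falsified by a satisfying assignment and residue 0;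
-- the task of C_j takes a literal of C_j that the assignment satisfies and residue r · (j + 1).
-- So a copy of y meets neither (its residue is nonzero modulo r(y), theirs is zero), f_i and
-- a clause task never share a literal, and two clause tasks with the same literal differ
-- modulo r², as j + 1 ≤ m < r.  With the classes pairwise disjoint, running at each time the
-- task whose class contains it is an exact periodic schedule.
module Submission where

open import Defs
open import Data.Nat as ℕ using (ℕ; zero; suc; _*_; _^_; _<_; _⊔_; pred; NonZero)
import Data.Nat.Properties as ℕ
import Data.Nat.Divisibility as ℕ
open import Data.Integer as ℤ using (ℤ; +_)
import Data.Integer.Properties as ℤ
open import Data.Integer.Divisibility.Signed
  using (_∣_; divides; _∣?_; ∣-trans; ∣ᵤ⇒∣; ∣⇒∣ᵤ; ∣m⇒∣-m; ∣m∣n⇒∣m+n; *-cancelˡ-∣)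
open import Data.Integer.Tactic.RingSolver using (solve-∀)
open import Data.Fin as Fin using (Fin; toℕ; combine; quotient; remainder; cast; #_)
import Data.Fin.Properties as Fin
open import Data.Bool using (true; false; not)
open import Data.Bool.Properties using (not-¬)
open import Data.Maybe using (Maybe; just; nothing)
open import Data.Product using (∃; ∃-syntax; _×_; _,_; proj₁; proj₂)
open import Data.Sum using (inj₁; inj₂)
open import Data.Empty using (⊥-elim)
open import Data.List
  using (List; []; _∷_; _++_; map; concatMap; replicate; length; lookup; allFin)
import Data.List.Properties as List
open import Data.List.Relation.Unary.All as All using (All; []; _∷_)
import Data.List.Relation.Unary.All.Properties as Allₚ
open import Data.List.Relation.Unary.AllPairs as AllPairs using ([]; _∷_)
import Data.List.Relation.Unary.AllPairs.Properties as AllPairsₚ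
open import Data.List.Relation.Unary.Unique.Propositional using (Unique)
import Data.List.Relation.Unary.Unique.Propositional.Properties as Uniqueₚ
open import Data.List.Relation.Binary.Disjoint.Propositional using (Disjoint)
open import Data.List.Membership.Propositional.Properties using (∈-lookup)
open import Function using (_∘_; const; id)
open import Relation.Nullary using (Dec; yes; no; ¬_; contradiction)
open import Relation.Nullary.Decidable using (map′)
open import Relation.Binary.PropositionalEquality

square-∣ : ∀ {a b} → a ℕ.∣ b → a * a ℕ.∣ b ^ 2
square-∣ a∣b = ℕ.*-pres-∣ a∣b (ℕ.∣m⇒∣m*n 1 a∣b)

m*pred[m]≡m^2∸m : ∀ m → m * pred m ≡ m ^ 2 ℕ.∸ m
m*pred[m]≡m^2∸m m = begin
  m * pred m        ≡⟨ cong (m *_) (ℕ.pred[m∸n]≡m∸[1+n] m 0) ⟩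
  m * (m ℕ.∸ 1)     ≡⟨ ℕ.*-distribˡ-∸ m m 1 ⟩
  m * m ℕ.∸ m * 1   ≡⟨ cong₂ ℕ._∸_ (cong (m *_) (sym (ℕ.*-identityʳ m))) (ℕ.*-identityʳ m) ⟩
  m ^ 2 ℕ.∸ m       ∎
  where open ≡-Reasoning

infix 4 _≡_[mod_] _≡?_[mod_]

record _≡_[mod_] (x y : ℤ) (n : ℕ) : Set where
  constructor congruent
  field n∣x-y : + n ∣ x ℤ.- y

open _≡_[mod_]

_≡?_[mod_] : ∀ x y n → Dec (x ≡ y [mod n ])
x ≡? y [mod n ] = map′ congruent n∣x-y (+ n ∣? x ℤ.- y)

module _ {n : ℕ} where

  ≡[mod]-refl : ∀ {x} → x ≡ x [mod n ]
  ≡[mod]-refl {x} = congruent (divides (+ 0) (ℤ.+-inverseʳ x))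

  ≡[mod]-sym : ∀ {x y} → x ≡ y [mod n ] → y ≡ x [mod n ]
  ≡[mod]-sym {x} {y} (congruent n∣x-y) =
    congruent (subst (+ n ∣_) (swap x y) (∣m⇒∣-m n∣x-y))
    where
    swap : ∀ x y → ℤ.- (x ℤ.- y) ≡ y ℤ.- x
    swap = solve-∀

  ≡[mod]-trans : ∀ {x y z} → x ≡ y [mod n ] → y ≡ z [mod n ] → x ≡ z [mod n ]
  ≡[mod]-trans {x} {y} {z} (congruent n∣x-y) (congruent n∣y-z) =
    congruent (subst (+ n ∣_) (telescope x y z) (∣m∣n⇒∣m+n n∣x-y n∣y-z))
    where
    telescope : ∀ x y z → (x ℤ.- y) ℤ.+ (y ℤ.- z) ≡ x ℤ.- z
    telescope = solve-∀

  ≡[mod]-∣ : ∀ {d x y} → d ℕ.∣ n → x ≡ y [mod n ] → x ≡ y [mod d ]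
  ≡[mod]-∣ d∣n (congruent n∣x-y) = congruent (∣-trans (∣ᵤ⇒∣ d∣n) n∣x-y)

  +-modulus-≡[mod] : ∀ x → x ℤ.+ + n ≡ x [mod n ]
  +-modulus-≡[mod] x = congruent (divides (+ 1) (difference x (+ n)))
    where
    difference : ∀ x n → (x ℤ.+ n) ℤ.- x ≡ ℤ.1ℤ ℤ.* n
    difference = solve-∀

  -‿modulus-≡[mod] : ∀ x → x ℤ.- + n ≡ x [mod n ]
  -‿modulus-≡[mod] x = congruent (divides (ℤ.- + 1) (difference x (+ n)))
    where
    difference : ∀ x n → (x ℤ.- n) ℤ.- x ≡ ℤ.- ℤ.1ℤ ℤ.* n
    difference = solve-∀

  +-multiple-≡[mod] : ∀ x k → x ℤ.+ + n ℤ.* k ≡ x [mod n ]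
  +-multiple-≡[mod] x k = congruent (divides k (difference x (+ n) k))
    where
    difference : ∀ x n k → (x ℤ.+ n ℤ.* k) ℤ.- x ≡ k ℤ.* n
    difference = solve-∀

  multiple-≡[mod]-0 : ∀ k → + n ℤ.* k ≡ + 0 [mod n ]
  multiple-≡[mod]-0 k = congruent (divides k (difference (+ n) k))
    where
    difference : ∀ n k → n ℤ.* k ℤ.- ℤ.0ℤ ≡ k ℤ.* n
    difference = solve-∀

  +-cancelˡ-≡[mod] : ∀ z {x y} → z ℤ.+ x ≡ z ℤ.+ y [mod n ] → x ≡ y [mod n ]
  +-cancelˡ-≡[mod] z {x} {y} (congruent n∣) =
    congruent (subst (+ n ∣_) (cancel z x y) n∣)
    where
    cancel : ∀ z x y → (z ℤ.+ x) ℤ.- (z ℤ.+ y) ≡ x ℤ.- y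
    cancel = solve-∀

*-cancelˡ-≡[mod] : ∀ k {n x y} .{{_ : NonZero k}} →
                   + k ℤ.* x ≡ + k ℤ.* y [mod k * n ] → x ≡ y [mod n ]
*-cancelˡ-≡[mod] k {n} {x} {y} (congruent kn∣) =
  congruent (*-cancelˡ-∣ (+ k) (subst₂ _∣_ (ℤ.pos-* k n) (factor (+ k) x y) kn∣))
  where
  factor : ∀ k x y → k ℤ.* x ℤ.- k ℤ.* y ≡ k ℤ.* (x ℤ.- y)
  factor = solve-∀

≡[mod]-common : ∀ {t x y n n' d} → d ℕ.∣ n → d ℕ.∣ n' →
                t ≡ x [mod n ] → t ≡ y [mod n' ] → x ≡ y [mod d ]
≡[mod]-common d∣n d∣n' t≡x t≡y =
  ≡[mod]-trans (≡[mod]-sym (≡[mod]-∣ d∣n t≡x)) (≡[mod]-∣ d∣n' t≡y)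

∣-small⇒≡0 : ∀ {n k} → k < n → n ℕ.∣ k → k ≡ 0
∣-small⇒≡0 {k = zero}  _   _   = refl
∣-small⇒≡0 {k = suc _} k<n n∣k = contradiction n∣k (ℕ.>⇒∤ k<n)

private
  ≡[mod]⇒≡-≤ : ∀ {n a b} → a ℕ.≤ b → b < n → + b ≡ + a [mod n ] → b ≡ a
  ≡[mod]⇒≡-≤ {n} {a} {b} a≤b b<n (congruent n∣b-a) =
    ℕ.≤-antisym (ℕ.m∸n≡0⇒m≤n (∣-small⇒≡0 b∸a<n (∣⇒∣ᵤ n∣b∸a))) a≤b
    where
    b∸a<n = ℕ.≤-<-trans (ℕ.m∸n≤m b a) b<n
    n∣b∸a : + n ∣ + (b ℕ.∸ a)
    n∣b∸a = subst (+ n ∣_) (trans (ℤ.m-n≡m⊖n b a) (ℤ.≤-⊖ a≤b)) n∣b-a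

≡[mod]⇒≡ : ∀ {n a b} → a < n → b < n → + a ≡ + b [mod n ] → a ≡ b
≡[mod]⇒≡ {a = a} {b} a<n b<n a≡b with ℕ.≤-total a b
... | inj₁ a≤b = sym (≡[mod]⇒≡-≤ a≤b b<n (≡[mod]-sym a≡b))
... | inj₂ b≤a = ≡[mod]⇒≡-≤ b≤a a<n a≡b

+-≢[mod] : ∀ {n t d} → + 0 ℤ.< d → d ℤ.< + n → ¬ t ℤ.+ d ≡ t [mod n ]
+-≢[mod] {n} {t} (ℤ.+<+ {n = k} 0<k) (ℤ.+<+ k<n) t+k≡t =
  ℕ.<⇒≢ 0<k (sym (≡[mod]⇒≡ k<n (ℕ.m<n⇒0<n k<n) k≡0))
  where
  k≡0 : + k ≡ + 0 [mod n ]
  k≡0 = +-cancelˡ-≡[mod] t (subst (λ s → t ℤ.+ + k ≡ s [mod n ]) (sym (ℤ.+-identityʳ t)) t+k≡t)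

low-digit-≡ : ∀ {M c c' s s'} → c < M → c' < M →
              + c ℤ.+ + M ℤ.* s ≡ + c' ℤ.+ + M ℤ.* s' [mod M ] → c ≡ c'
low-digit-≡ {c = c} {c'} {s} {s'} c<M c'<M e = ≡[mod]⇒≡ c<M c'<M
  (≡[mod]-trans (≡[mod]-sym (+-multiple-≡[mod] (+ c) s))
                (≡[mod]-trans e (+-multiple-≡[mod] (+ c') s')))

high-digit-≡[mod] : ∀ {M d c c' s s'} .{{_ : NonZero M}} → c ≡ c' →
                    + c ℤ.+ + M ℤ.* s ≡ + c' ℤ.+ + M ℤ.* s' [mod M * d ] → s ≡ s' [mod d ]
high-digit-≡[mod] {M} {c = c} refl e = *-cancelˡ-≡[mod] M (+-cancelˡ-≡[mod] (+ c) e)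

lookup-map : ∀ {A B : Set} (f : A → B) xs i →
             lookup (map f xs) i ≡ f (lookup xs (cast (List.length-map f xs) i))
lookup-map f (x ∷ xs) Fin.zero    = refl
lookup-map f (x ∷ xs) (Fin.suc i) = lookup-map f xs i

cast-injective : ∀ {m n} .(eq : m ≡ n) {i j : Fin m} → cast eq i ≡ cast eq j → i ≡ j
cast-injective eq {i} {j} e =
  Fin.toℕ-injective (trans (sym (Fin.toℕ-cast eq i)) (trans (cong toℕ e) (Fin.toℕ-cast eq j)))

Unique-lookup-injective : ∀ {A : Set} {xs : List A} → Unique xs →
                          ∀ {i j} → lookup xs i ≡ lookup xs j → i ≡ j
Unique-lookup-injective (_    ∷ _)   {Fin.zero}  {Fin.zero}  _ = refl
Unique-lookup-injective (x∉xs ∷ _)   {Fin.zero}  {Fin.suc j} e =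
  contradiction e (All.lookup x∉xs (∈-lookup j))
Unique-lookup-injective (x∉xs ∷ _)   {Fin.suc i} {Fin.zero}  e =
  contradiction (sym e) (All.lookup x∉xs (∈-lookup i))
Unique-lookup-injective (_    ∷ xs!) {Fin.suc i} {Fin.suc j} e =
  cong Fin.suc (Unique-lookup-injective xs! e)

map-const : ∀ {A B : Set} (b : B) (xs : List A) → map (const b) xs ≡ replicate (length xs) b
map-const b []       = refl
map-const b (x ∷ xs) = cong (b ∷_) (map-const b xs)

map-allFin-Unique : ∀ {A : Set} {n} {f : Fin n → A} → (∀ {x y} → f x ≡ f y → x ≡ y) →
                    Unique (map f (allFin n))
map-allFin-Unique {n = n} f-injective = Uniqueₚ.map⁺ f-injective (Uniqueₚ.allFin⁺ n)

All-All¬⇒Disjoint : ∀ {A : Set} {P : A → Set} {xs ys} →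
                    All P xs → All (¬_ ∘ P) ys → Disjoint xs ys
All-All¬⇒Disjoint Pxs ¬Pys (v∈xs , v∈ys) = All.lookup ¬Pys v∈ys (All.lookup Pxs v∈xs)

concatMap-Unique⁺ : ∀ {A B : Set} (f : B → A) {g : A → List B} {xs} →
                    Unique xs → (∀ x → Unique (g x)) → (∀ x → All (λ b → f b ≡ x) (g x)) →
                    Unique (concatMap g xs)
concatMap-Unique⁺ f {g} xs! g! g-fibre =
  Uniqueₚ.concat⁺ (Allₚ.map⁺ (All.universal g! _)) (AllPairsₚ.map⁺ (AllPairs.map fibres-disjoint xs!))
  where
  fibres-disjoint : ∀ {x y} → x ≢ y → Disjoint (g x) (g y)
  fibres-disjoint x≢y (b∈gx , b∈gy) =
    x≢y (trans (sym (All.lookup (g-fibre _) b∈gx)) (All.lookup (g-fibre _) b∈gy))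

-- Exact periodic schedules from pairwise disjoint residue classes

module _ (a : List ℕ) (offset : Fin (length a) → ℤ)
         (disjoint : ∀ i j {t} → t ≡ offset i [mod lookup a i ] →
                                 t ≡ offset j [mod lookup a j ] → i ≡ j)
         where

  private
    Occupies : ℤ → Fin (length a) → Set
    Occupies t i = t ≡ offset i [mod lookup a i ]

    occupant : ∀ {t} → Dec (∃ (Occupies t)) → Maybe (Fin (length a))
    occupant (yes (i , _)) = just i
    occupant (no _)        = nothing

    occupant-sound : ∀ {t i} (d : Dec (∃ (Occupies t))) → occupant d ≡ just i → Occupies t i
    occupant-sound (yes (_ , t∈i)) refl = t∈i

    occupant-complete : ∀ {t i} (d : Dec (∃ (Occupies t))) → Occupies t i → occupant d ≡ just i
    occupant-complete (yes (j , t∈j)) t∈i = cong just (disjoint j _ t∈j t∈i)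
    occupant-complete (no ∄)          t∈i = contradiction (_ , t∈i) ∄

    σ : ℤ → Maybe (Fin (length a))
    σ t = occupant (Fin.any? λ i → t ≡? offset i [mod lookup a i ])

    σ-sound : ∀ {t i} → σ t ≡ just i → Occupies t i
    σ-sound = occupant-sound (Fin.any? _)

    σ-complete : ∀ {t i} → Occupies t i → σ t ≡ just i
    σ-complete = occupant-complete (Fin.any? _)

  residueSchedule : HasEPSSchedule a
  residueSchedule = σ , λ i →
      (offset i , σ-complete ≡[mod]-refl)
    , λ t σt≡i → let t∈i = σ-sound σt≡i in
        σ-complete (≡[mod]-trans (+-modulus-≡[mod] t) t∈i)
      , σ-complete (≡[mod]-trans (-‿modulus-≡[mod] t) t∈i)
      , λ d 0<d d<a σt+d≡i → +-≢[mod] 0<d d<a (≡[mod]-trans (σ-sound σt+d≡i) (≡[mod]-sym t∈i))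

module _ {T : Set} (period : T → ℕ) (offset : T → ℤ) where

  taskSchedule : (ts : List T) → Unique ts →
                 (∀ τ τ' {t} → t ≡ offset τ [mod period τ ] →
                               t ≡ offset τ' [mod period τ' ] → τ ≡ τ') →
                 HasEPSSchedule (map period ts)
  taskSchedule ts ts! disjoint = residueSchedule (map period ts) (offset ∘ task) λ i j t∈i t∈j →
    cast-injective eq (Unique-lookup-injective ts! (disjoint _ _ (retype i t∈i) (retype j t∈j)))
    where
    eq = List.length-map period ts
    task : Fin (length (map period ts)) → T
    task i = lookup ts (cast eq i)
    retype : ∀ {t} i → t ≡ offset (task i) [mod lookup (map period ts) i ] →
                       t ≡ offset (task i) [mod period (task i) ]
    retype {t} i = subst (λ n → t ≡ offset (task i) [mod n ]) (lookup-map period ts i)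

code : ∀ {n} → Literal n → Fin (n * 2)
code (i , true)  = combine i (# 0)
code (i , false) = combine i (# 1)

code-injective : ∀ {n} {y y' : Literal n} → code y ≡ code y' → y ≡ y'
code-injective {y = i , true}  {i' , true}  e = cong (_, true) (Fin.combine-injectiveˡ i _ i' _ e)
code-injective {y = i , false} {i' , false} e = cong (_, false) (Fin.combine-injectiveˡ i _ i' _ e)
code-injective {y = i , true}  {i' , false} e with () ← Fin.combine-injectiveʳ i _ i' _ e
code-injective {y = i , false} {i' , true}  e with () ← Fin.combine-injectiveʳ i _ i' _ e

code<2n : ∀ {n} (y : Literal n) → toℕ (code y) < 2 * n
code<2n {n} y = subst (toℕ (code y) <_) (ℕ.*-comm n 2) (Fin.toℕ<n (code y))

rep1≡p∘code : ∀ {n} p (y : Literal n) → rep1 p y ≡ p (toℕ (code y))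
rep1≡p∘code p (i , true)  = cong p (sym (trans (Fin.toℕ-combine i (# 0)) (ℕ.+-identityʳ _)))
rep1≡p∘code p (i , false) = cong p (sym (Fin.toℕ-combine i (# 1)))

rep1-above : ∀ {B n p} → FirstPrimesAbove B (2 * n) p → (y : Literal n) → B < rep1 p y
rep1-above {B} {p = p} (primesAbove , _) y =
  subst (B <_) (sym (rep1≡p∘code p y)) (proj₂ (primesAbove _ (code<2n y)))

module Reduction (C : Instance) (p : ℕ → ℕ) (m<rep1 : ∀ (y : Literal (n C)) → m C < rep1 p y)
                 (α : Assignment (n C)) (α⊨C : ∀ j → ∃[ k ] litTrue α (clause C j k)) where

  N : ℕ
  N = n C

  r : Literal N → ℕ
  r = rep1 p

  r-nonZero : ∀ y → NonZero (r y)
  r-nonZero y = ℕ.>-nonZero (ℕ.m<n⇒0<n (m<rep1 y))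

  chosen : Fin (m C) → Literal N
  chosen j = clause C j (proj₁ (α⊨C j))

  falsified≢chosen : ∀ i j → (i , not (α i)) ≢ chosen j
  falsified≢chosen i j e = not-¬ refl (subst (litTrue α) (sym e) (proj₂ (α⊨C j)))

  data Task : Set where
    litTask    : (y : Literal N) → Fin (r y * pred (r y)) → Task
    varTask    : Fin N → Task
    clauseTask : Fin (m C) → Task

  lit : Task → Literal N
  lit (litTask y _)  = y
  lit (varTask i)    = i , not (α i)
  lit (clauseTask j) = chosen j

  Q : Task → ℕ
  Q (litTask y _)  = r y ^ 2
  Q (varTask i)    = r (i , true) * r (i , false)
  Q (clauseTask j) = (r (clause C j (# 0)) * r (clause C j (# 1)) * r (clause C j (# 2))) ^ 2

  -- Copy k of y, read as the digits (a , b) with a < r and b < r - 1, gets the residue (b + 1) + r a.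
  residue : Task → ℤ
  residue (litTask y k)  = + suc (toℕ (remainder {r y} (pred (r y)) k))
                           ℤ.+ + r y ℤ.* + toℕ (quotient {r y} (pred (r y)) k)
  residue (varTask i)    = + 0
  residue (clauseTask j) = + r (chosen j) ℤ.* + suc (toℕ j)

  period : Task → ℕ
  period τ = 2 * N * Q τ

  offset : Task → ℤ
  offset τ = + toℕ (code (lit τ)) ℤ.+ + (2 * N) ℤ.* residue τ

  r∣clause : ∀ j k →
             r (clause C j k) ℕ.∣ r (clause C j (# 0)) * r (clause C j (# 1)) * r (clause C j (# 2))
  r∣clause j Fin.zero                     = ℕ.∣-trans (ℕ.m∣m*n _) (ℕ.m∣m*n _)
  r∣clause j (Fin.suc Fin.zero)           = ℕ.n∣m*n*o (r (clause C j (# 0))) (r (clause C j (# 2)))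
  r∣clause j (Fin.suc (Fin.suc Fin.zero)) = ℕ.n∣m*n (r (clause C j (# 0)) * r (clause C j (# 1)))

  r∣Q : ∀ τ → r (lit τ) ℕ.∣ Q τ
  r∣Q (litTask y _)  = ℕ.m∣m*n _
  r∣Q (varTask i) with α i
  ... | true  = ℕ.n∣m*n (r (i , true))
  ... | false = ℕ.m∣m*n (r (i , false))
  r∣Q (clauseTask j) = ℕ.∣-trans (r∣clause j (proj₁ (α⊨C j))) (ℕ.m∣m*n _)

  r²∣Q-clause : ∀ j → r (chosen j) * r (chosen j) ℕ.∣ Q (clauseTask j)
  r²∣Q-clause j = square-∣ (r∣clause j (proj₁ (α⊨C j)))

  1+remainder<r : ∀ y k → suc (toℕ (remainder {r y} (pred (r y)) k)) < r y
  1+remainder<r y k =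
    ℕ.m≤pred[n]⇒suc[m]≤n {{r-nonZero y}} (Fin.toℕ<n (remainder {r y} (pred (r y)) k))

  1+j<r : ∀ j → suc (toℕ j) < r (chosen j)
  1+j<r j = ℕ.≤-<-trans (Fin.toℕ<n j) (m<rep1 (chosen j))

  Compatible : Task → Task → Set
  Compatible τ τ' =
    lit τ ≡ lit τ' × (∀ {d} → d ℕ.∣ Q τ → d ℕ.∣ Q τ' → residue τ ≡ residue τ' [mod d ])

  Compatible-sym : ∀ {τ τ'} → Compatible τ τ' → Compatible τ' τ
  Compatible-sym (e , same) = sym e , λ d∣Q' d∣Q → ≡[mod]-sym (same d∣Q d∣Q')

  shared-time⇒Compatible : ∀ {τ τ' t} → t ≡ offset τ [mod period τ ] →
                           t ≡ offset τ' [mod period τ' ] → Compatible τ τ'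
  shared-time⇒Compatible {τ} {τ'} t∈τ t∈τ' =
    code-injective (Fin.toℕ-injective same-code) , same-residue
    where
    instance
      2N-nonZero : NonZero (2 * N)
      2N-nonZero = ℕ.>-nonZero (ℕ.m<n⇒0<n (code<2n (lit τ)))
    same-code : toℕ (code (lit τ)) ≡ toℕ (code (lit τ'))
    same-code = low-digit-≡ {M = 2 * N} (code<2n (lit τ)) (code<2n (lit τ'))
      (≡[mod]-common (ℕ.m∣m*n _) (ℕ.m∣m*n _) t∈τ t∈τ')
    same-residue : ∀ {d} → d ℕ.∣ Q τ → d ℕ.∣ Q τ' → residue τ ≡ residue τ' [mod d ]
    same-residue d∣Q d∣Q' = high-digit-≡[mod] {M = 2 * N} same-code
      (≡[mod]-common (ℕ.*-monoʳ-∣ (2 * N) d∣Q) (ℕ.*-monoʳ-∣ (2 * N) d∣Q') t∈τ t∈τ')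

  litTask-injective : ∀ {y k k'} → Compatible (litTask y k) (litTask y k') → k ≡ k'
  litTask-injective {y} {k} {k'} (_ , same) = begin
    k                           ≡⟨ sym (Fin.combine-remQuot {r y} (pred (r y)) k) ⟩
    combine (quot k) (rem k)    ≡⟨ cong₂ combine same-quot same-rem ⟩
    combine (quot k') (rem k')  ≡⟨ Fin.combine-remQuot {r y} (pred (r y)) k' ⟩
    k'                          ∎
    where
    open ≡-Reasoning
    instance _ = r-nonZero y
    quot = quotient {r y} (pred (r y))
    rem  = remainder {r y} (pred (r y))
    same-low : suc (toℕ (rem k)) ≡ suc (toℕ (rem k'))
    same-low = low-digit-≡ (1+remainder<r y k) (1+remainder<r y k') (same (ℕ.m∣m*n _) (ℕ.m∣m*n _))
    same-rem : rem k ≡ rem k'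
    same-rem = Fin.toℕ-injective (ℕ.suc-injective same-low)
    r²∣r² = square-∣ {r y} ℕ.∣-refl
    same-quot : quot k ≡ quot k'
    same-quot = Fin.toℕ-injective (≡[mod]⇒≡ (Fin.toℕ<n (quot k)) (Fin.toℕ<n (quot k'))
      (high-digit-≡[mod] {M = r y} same-low (same r²∣r² r²∣r²)))

  litTask-incompatible : ∀ {y} k τ → residue τ ≡ + 0 [mod r (lit τ) ] → ¬ Compatible (litTask y k) τ
  litTask-incompatible k τ residue≡0 (refl , same) =
    ℕ.1+n≢0 (≡[mod]⇒≡ 1+b<r (ℕ.m<n⇒0<n 1+b<r) (≡[mod]-trans low≡residue residue≡0))
    where
    1+b<r = 1+remainder<r (lit τ) k
    low≡residue = ≡[mod]-trans (≡[mod]-sym (+-multiple-≡[mod] _ _)) (same (ℕ.m∣m*n _) (r∣Q τ))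

  clauseTask-injective : ∀ {j j'} → Compatible (clauseTask j) (clauseTask j') → j ≡ j'
  clauseTask-injective {j} {j'} (e , same) = Fin.toℕ-injective (ℕ.suc-injective
    (≡[mod]⇒≡ (1+j<r j) 1+j'<R (*-cancelˡ-≡[mod] R {{r-nonZero (chosen j)}} same-residue)))
    where
    R = r (chosen j)
    1+j'<R : suc (toℕ j') < R
    1+j'<R = subst (λ y → suc (toℕ j') < r y) (sym e) (1+j<r j')
    R²∣Q' : R * R ℕ.∣ Q (clauseTask j')
    R²∣Q' = subst (λ y → r y * r y ℕ.∣ Q (clauseTask j')) (sym e) (r²∣Q-clause j')
    same-residue : + R ℤ.* + suc (toℕ j) ≡ + R ℤ.* + suc (toℕ j') [mod R * R ]
    same-residue = subst (λ y → + R ℤ.* + suc (toℕ j) ≡ + r y ℤ.* + suc (toℕ j') [mod R * R ])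
                         (sym e) (same (r²∣Q-clause j) R²∣Q')

  Compatible⇒≡ : ∀ τ τ' → Compatible τ τ' → τ ≡ τ'
  Compatible⇒≡ (litTask y k)    (litTask .y k')   c@(refl , _) = cong (litTask y) (litTask-injective c)
  Compatible⇒≡ (litTask _ k)    τ'@(varTask _)    c =
    ⊥-elim (litTask-incompatible k τ' ≡[mod]-refl c)
  Compatible⇒≡ (litTask _ k)    τ'@(clauseTask _) c =
    ⊥-elim (litTask-incompatible k τ' (multiple-≡[mod]-0 _) c)
  Compatible⇒≡ τ@(varTask _)    τ'@(litTask _ k)  c =
    ⊥-elim (litTask-incompatible k τ ≡[mod]-refl (Compatible-sym {τ} {τ'} c))
  Compatible⇒≡ τ@(clauseTask _) τ'@(litTask _ k)  c =
    ⊥-elim (litTask-incompatible k τ (multiple-≡[mod]-0 _) (Compatible-sym {τ} {τ'} c))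
  Compatible⇒≡ (varTask _)      (varTask _)       (e , _) = cong (varTask ∘ var) e
  Compatible⇒≡ (varTask i)      (clauseTask j)    (e , _) = ⊥-elim (falsified≢chosen i j e)
  Compatible⇒≡ (clauseTask j)   (varTask i)       (e , _) = ⊥-elim (falsified≢chosen i j (sym e))
  Compatible⇒≡ (clauseTask _)   (clauseTask _)    c = cong clauseTask (clauseTask-injective c)

  literals : List (Literal N)
  literals = concatMap (λ i → (i , true) ∷ (i , false) ∷ []) (allFinL N)

  copies : Literal N → List Task
  copies y = map (litTask y) (allFin (r y * pred (r y)))

  copyTasks varTasks clauseTasks tasks : List Task
  copyTasks   = concatMap copies literals
  varTasks    = map varTask (allFinL N)
  clauseTasks = map clauseTask (allFinL (m C))
  tasks       = copyTasks ++ varTasks ++ clauseTasks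

  map-period-copies : ∀ y → map period (copies y) ≡ replicate (r y ^ 2 ℕ.∸ r y) (2 * N * r y ^ 2)
  map-period-copies y = begin
    map period (map (litTask y) (allFin K))  ≡⟨ sym (List.map-∘ (allFin K)) ⟩
    map (const v) (allFin K)                 ≡⟨ map-const v (allFin K) ⟩
    replicate (length (allFin K)) v          ≡⟨ cong (λ l → replicate l v) (List.length-tabulate id) ⟩
    replicate K v                            ≡⟨ cong (λ l → replicate l v) (m*pred[m]≡m^2∸m (r y)) ⟩
    replicate (r y ^ 2 ℕ.∸ r y) v            ∎
    where
    open ≡-Reasoning
    K = r y * pred (r y)
    v = 2 * N * r y ^ 2

  map-period-tasks : map period tasks ≡ redEPS C p
  map-period-tasks =
    trans (List.map-++ period copyTasks (varTasks ++ clauseTasks))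
          (cong₂ _++_ copy-periods
                      (trans (List.map-++ period varTasks clauseTasks) (cong₂ _++_ var-periods clause-periods)))
    where
    copy-periods : map period copyTasks ≡
                   concatMap (λ y → replicate (r y ^ 2 ℕ.∸ r y) (2 * N * r y ^ 2)) literals
    copy-periods = trans (List.map-concatMap period copies literals)
                         (List.concatMap-cong map-period-copies literals)
    var-periods : map period varTasks ≡ map (λ i → 2 * N * r (i , true) * r (i , false)) (allFinL N)
    var-periods = trans (sym (List.map-∘ (allFinL N)))
                        (List.map-cong (λ i → sym (ℕ.*-assoc (2 * N) (r (i , true)) (r (i , false)))) _)
    clause-periods : map period clauseTasks ≡ map (period ∘ clauseTask) (allFinL (m C))
    clause-periods = sym (List.map-∘ (allFinL (m C)))

  data Kind : Set where
    copyKind varKind clauseKind : Kind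

  kind : Task → Kind
  kind (litTask _ _)  = copyKind
  kind (varTask _)    = varKind
  kind (clauseTask _) = clauseKind

  OfKind : Kind → Task → Set
  OfKind κ τ = kind τ ≡ κ

  tasks-Unique : Unique tasks
  tasks-Unique =
    Uniqueₚ.++⁺ copyTasks-Unique (Uniqueₚ.++⁺ varTasks-Unique clauseTasks-Unique varTasks#clauseTasks)
                copyTasks#others
    where
    literals-Unique : Unique literals
    literals-Unique = concatMap-Unique⁺ var (Uniqueₚ.allFin⁺ N)
      (λ _ → ((λ ()) ∷ []) ∷ [] ∷ []) (λ _ → refl ∷ refl ∷ [])
    copyTasks-Unique : Unique copyTasks
    copyTasks-Unique = concatMap-Unique⁺ lit literals-Unique
      (λ _ → map-allFin-Unique λ { refl → refl }) (λ _ → Allₚ.map⁺ (All.universal (λ _ → refl) _))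
    varTasks-Unique : Unique varTasks
    varTasks-Unique = map-allFin-Unique λ { refl → refl }
    clauseTasks-Unique : Unique clauseTasks
    clauseTasks-Unique = map-allFin-Unique λ { refl → refl }
    varTasks#clauseTasks : Disjoint varTasks clauseTasks
    varTasks#clauseTasks = All-All¬⇒Disjoint {P = OfKind varKind}
      (Allₚ.map⁺ (All.universal (λ _ → refl) (allFinL N)))
      (Allₚ.map⁺ (All.universal (λ _ ()) (allFinL (m C))))
    copyTasks#others : Disjoint copyTasks (varTasks ++ clauseTasks)
    copyTasks#others = All-All¬⇒Disjoint {P = OfKind copyKind}
      (Allₚ.concat⁺ (Allₚ.map⁺ (All.universal (λ _ → Allₚ.map⁺ (All.universal (λ _ → refl) _))
                                              literals)))
      (Allₚ.++⁺ (Allₚ.map⁺ (All.universal (λ _ ()) (allFinL N)))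
                (Allₚ.map⁺ (All.universal (λ _ ()) (allFinL (m C)))))

  schedule : HasEPSSchedule (redEPS C p)
  schedule = subst HasEPSSchedule map-period-tasks
    (taskSchedule period offset tasks tasks-Unique
      λ τ τ' t∈τ t∈τ' → Compatible⇒≡ τ τ' (shared-time⇒Compatible {τ} {τ'} t∈τ t∈τ'))

lemma10 : (C : Instance) (p : ℕ → ℕ) →
    FirstPrimesAbove (m C ⊔ n C) (2 * n C) p →
    Satisfiable C → HasEPSSchedule (redEPS C p)
lemma10 C p primes (α , α⊨C) = Reduction.schedule C p m<rep1 α α⊨C
  where
  m<rep1 : ∀ y → m C < rep1 p y
  m<rep1 y = ℕ.≤-<-trans (ℕ.m≤m⊔n (m C) (n C)) (rep1-above primes y)
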